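{- Let $r\ge3$, $\ell\ge1$, $a\ge r-2$ be integers and $d=r-1$. Let $E=L\cup\{e,f\}\cup A$ be a disjoint union with $|L|=\ell$, $|A|=a$, let $H=L\cup A$, and let $\mathcal{M}$ be the rank-$r$ matroid on $E$ whose bases are the $r$-subsets $B\subseteq E$ with $|B\cap(L\cup\{e,f\})|\le2$. Let $\{\mathbf{c}_S\in\mathbb{R}^n: S\subseteq H,\ |S|=d\}$ be vectors such that for every function $\alpha:H\to\{0,1,2\}$ with $\sum_h\alpha(h)=2d$, $$\sum_{(S,T)\in\mathcal{P}(\alpha)}\langle\mathbf{c}_S,\mathbf{c}_T\rangle=[\mathbf{y}^\alpha]\,\Delta M\{e,f\}.$$ Let $S,T\subseteq H$ with $|S|=|T|=d$ and let $p\in L$. Then: (a) $\langle\mathbf{c}_S,\mathbf{c}_S\rangle=1$ if $|S\cap L|\le1$, and $\mathbf{c}_S=\mathbf{0}$ if $|S\cap L|\ge2$; (b) if $S\cap L=T\cap L=\{p\}$, then $\mathbf{c}_S=\mathbf{c}_T$.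
   Context: Variables $\mathbf{y}=\{y_h:h\in E\}$, $\mathbf{y}^S=\prod_{h\in S}y_h$, and for $\alpha:H\to\{0,1,2\}$, $\mathbf{y}^\alpha=\prod_{h\in H}y_h^{\alpha(h)}$; $[\mathbf{y}^\alpha]F$ is the coefficient of $\mathbf{y}^\alpha$ in $F$. The basis enumerator is $M=\sum_B\mathbf{y}^B$ over bases $B$; for distinct $e,f$ write uniquely $M=M^{ef}+y_eM_e^f+y_fM_f^e+y_ey_fM_{ef}$ with the four polynomials free of $y_e,y_f$, and $\Delta M\{e,f\}=M_e^fM_f^e-M_{ef}M^{ef}$. $\mathcal{P}(\alpha)$ is the set of ordered pairs $(S,T)$ of $d$-element subsets of $H$ with $S\cap T=\alpha^{ -1}(2)$ and $S\triangle T=\alpha^{ -1}(1)$ (equivalently $\mathbf{y}^S\mathbf{y}^T=\mathbf{y}^\alpha$). $\langle\cdot,\cdot\rangle$ is the standard dot product on $\mathbb{R}^n$. -}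

module Defs where

open import Level using (Level; _⊔_) renaming (suc to lsuc)
open import Data.Nat using (ℕ; zero; suc; _≡ᵇ_; _≤ᵇ_; _<ᵇ_)
import Data.Nat as ℕ
open import Data.Bool using (Bool; true; false; _∧_; if_then_else_)
open import Data.Fin using (Fin; toℕ)
open import Data.Fin.Subset using (Subset; _∩_; ∣_∣)
open import Data.Vec using (Vec; []; _∷_; lookup; tabulate; zipWith)
import Data.Vec as Vec
open import Data.List using (List; []; _∷_; _++_; map; filter; length; concatMap; allFin)
open import Data.Nat.ListAction using (sum)
import Data.Bool.ListAction
import Data.List as List
open import Data.Integer using (ℤ; +_; -[1+_])
import Data.Integer as ℤ
open import Data.Product using (_×_; _,_; ∃)
open import Relation.Nullary using (¬_)
open import Relation.Binary.Structures using (IsTotalOrder)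
open import Algebra.Bundles using (CommutativeRing)
open import Relation.Binary.PropositionalEquality using (_≡_)
open import Relation.Nullary.Decidable using (Dec; yes; no)

record RealField (c ℓ₁ ℓ₂ : Level) : Set (lsuc (c ⊔ ℓ₁ ⊔ ℓ₂)) where
  field
    commutativeRing : CommutativeRing c ℓ₁
  open CommutativeRing commutativeRing public
  field
    _≤_          : Carrier → Carrier → Set ℓ₂
    isTotalOrder : IsTotalOrder _≈_ _≤_
    +-mono-≤     : ∀ {x y} z → x ≤ y → (x + z) ≤ (y + z)
    *-nonneg     : ∀ {x y} → 0# ≤ x → 0# ≤ y → 0# ≤ (x * y)
    0≉1          : ¬ (0# ≈ 1#)
    inverse      : ∀ x → ¬ (x ≈ 0#) → ∃ λ y → (x * y) ≈ 1#
    sup          : (P : Carrier → Set c) → ∃ P → ∃ (λ b → ∀ x → P x → x ≤ b) →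
                   ∃ λ s → (∀ x → P x → x ≤ s) × (∀ b → (∀ x → P x → x ≤ b) → s ≤ b)

module _ {c ℓ₁ ℓ₂} (R : RealField c ℓ₁ ℓ₂) where
  open RealField R

  dot : ∀ {n} → Vec Carrier n → Vec Carrier n → Carrier
  dot u v = Vec.foldr _ _+_ 0# (zipWith _*_ u v)

  fromℕ : ℕ → Carrier
  fromℕ zero    = 0#
  fromℕ (suc k) = 1# + fromℕ k

  fromℤ : ℤ → Carrier
  fromℤ (+ k)      = fromℕ k
  fromℤ -[1+ k ]   = - fromℕ (suc k)

-- Finite sets.  H = L ∪ A is Fin (l ℕ.+ a), L = the first l elements.
-- A subset of E = L ∪ {e,f} ∪ A is a triple (X ⊆ H, e ∈?, f ∈?).

allSubsets : ∀ n → List (Subset n)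
allSubsets zero    = [] ∷ []
allSubsets (suc n) = map (true ∷_) (allSubsets n) ++ map (false ∷_) (allSubsets n)

Lset : ∀ l a → Subset (l ℕ.+ a)
Lset l a = tabulate (λ i → toℕ i <ᵇ l)

b2n : Bool → ℕ
b2n true  = 1
b2n false = 0

isBasis : ∀ r l a → Subset (l ℕ.+ a) → Bool → Bool → Bool
isBasis r l a X be bf =
  ((∣ X ∣ ℕ.+ b2n be ℕ.+ b2n bf) ≡ᵇ r) ∧ ((∣ X ∩ Lset l a ∣ ℕ.+ b2n be ℕ.+ b2n bf) ≤ᵇ 2)

-- A multilinear polynomial with 0/1 coefficients in the variables y_h (h ∈ H),
-- represented as the list of its monomials y^X.
-- M = M^{ef} + y_e M_e^f + y_f M_f^e + y_e y_f M_{ef}, where the part with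
-- e-membership be and f-membership bf is:
Mpart : ∀ r l a → Bool → Bool → List (Subset (l ℕ.+ a))
Mpart r l a be bf = filter (λ X → Data.Bool.T? (isBasis r l a X be bf)) (allSubsets (l ℕ.+ a))
  where import Data.Bool

-- exponent of y_h in y^S y^T equals α(h), for all h  (i.e. y^S y^T = y^α)
monoEq : ∀ {N} → Subset N → Subset N → (Fin N → Fin 3) → Bool
monoEq {N} S T α =
  Data.Bool.ListAction.and (map (λ h → (b2n (lookup S h) ℕ.+ b2n (lookup T h)) ≡ᵇ toℕ (α h)) (allFin N))

pairs : ∀ {A : Set} → List A → List A → List (A × A)
pairs xs ys = concatMap (λ x → map (x ,_) ys) xs

-- [y^α] (P · Q) for 0/1 multilinear polynomials P, Q given by monomial lists
coeffProd : ∀ {N} → List (Subset N) → List (Subset N) → (Fin N → Fin 3) → ℕ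
coeffProd P Q α = length (filter (λ p → Data.Bool.T? (monoEq (Data.Product.proj₁ p) (Data.Product.proj₂ p) α)) (pairs P Q))
  where import Data.Bool; import Data.Product

-- [y^α] ΔM{e,f} = [y^α](M_e^f M_f^e) - [y^α](M_{ef} M^{ef})
coeffΔM : ∀ r l a → (Fin (l ℕ.+ a) → Fin 3) → ℤ
coeffΔM r l a α =
  + coeffProd (Mpart r l a true false) (Mpart r l a false true) α
  ℤ.- + coeffProd (Mpart r l a true true) (Mpart r l a false false) α

weight : ∀ {N} → (Fin N → Fin 3) → ℕ
weight {N} α = sum (map (λ h → toℕ (α h)) (allFin N))

𝒫 : ∀ {N} → ℕ → (Fin N → Fin 3) → List (Subset N × Subset N)
𝒫 {N} d α = filter (λ p → Data.Bool.T? (test p)) (pairs (allSubsets N) (allSubsets N))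
  where
    import Data.Bool
    test : Subset N × Subset N → Bool
    test (S , T) = (∣ S ∣ ≡ᵇ d) ∧ (∣ T ∣ ≡ᵇ d) ∧ monoEq S T α

module _ {c ℓ₁ ℓ₂} (R : RealField c ℓ₁ ℓ₂) where
  open RealField R

  sum𝒫 : ∀ {N n} → ℕ → (Subset N → Vec Carrier n) → (Fin N → Fin 3) → Carrier
  sum𝒫 d cv α = List.foldr (λ p acc → dot R (cv (Data.Product.proj₁ p)) (cv (Data.Product.proj₂ p)) + acc) 0# (𝒫 d α)
    where import Data.Product

module Submission where

-- The key choice of α is the exponent of y^S y^T.  For α = 2·S the only pair in
-- 𝒫(α) is (S, S), and of the two products in ΔM{e,f} only M_e^f M_f^e has a
-- y^{2S} term, namely when S ∪ {e} is a basis, i.e. |S ∩ L| ≤ 1; this gives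
-- ⟨c_S, c_S⟩ ∈ {0, 1} and (a).  If S ∩ L = T ∩ L = {p}, every (X, Y) ∈ 𝒫(y^S y^T)
-- has X ∩ L = Y ∩ L = {p}; then M_{ef} contributes nothing, M_e^f M_f^e contributes
-- one for each pair, and the hypothesis says ∑ ⟨c_X, c_Y⟩ = |𝒫|.  As all c_X are
-- unit vectors, ∑ |c_X − c_Y|² = 2|𝒫| − 2 ∑ ⟨c_X, c_Y⟩ = 0, whence c_S = c_T.
-- Positive definiteness of the dot product needs that a real x with x² = 0
-- vanishes, which is where completeness of the reals is used.

open import Defs
open import Data.Nat using (ℕ; zero; suc)
open import Data.Product using (Σ; _×_; _,_; proj₁; proj₂)
open import Data.Sum using (inj₁; inj₂)
open import Data.Empty using (⊥-elim)
open import Data.Fin using (Fin; zero; suc; toℕ; _↑ˡ_)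
open import Data.Vec using (Vec; []; _∷_; lookup; zipWith)
open import Data.Vec.Properties using (≡-dec; lookup-zipWith)
open import Data.List using (List; []; _∷_; _++_; map; filter; length; foldr; allFin; tabulate)
open import Data.List.Relation.Unary.All using (All; []; _∷_)
import Data.List.Relation.Unary.All as All
open import Relation.Binary.Structures using (IsTotalOrder)
import Relation.Binary.PropositionalEquality as ≡
open ≡ using (_≡_)

-- Ordered fields

module OrderedFieldProperties {c ℓ₁ ℓ₂} (R : RealField c ℓ₁ ℓ₂) where
  open RealField R
  open IsTotalOrder isTotalOrder
    using (total; antisym; ≤-respˡ-≈; ≤-respʳ-≈) renaming (trans to ≤-trans; refl to ≤-refl)
  open import Algebra.Properties.Ring ring
    using (-‿involutive; -‿distribˡ-*; -‿distribʳ-*; x[y-z]≈xy-xz; +-identityˡ-unique; //-rightDividesˡ; x∙y⁻¹≈ε⇒x≈y; xyx⁻¹≈y)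
  open import Algebra.Properties.CommutativeSemigroup +-commutativeSemigroup using (interchange)
  open import Algebra.Properties.CommutativeSemigroup *-commutativeSemigroup
    using () renaming (interchange to *-interchange)
  open import Algebra.Solver.Ring.NaturalCoefficients.Default commutativeSemiring
  open import Relation.Binary.Reasoning.Setoid setoid

  x≤y⇒0≤y-x : ∀ {x y} → x ≤ y → 0# ≤ (y - x)
  x≤y⇒0≤y-x {x} x≤y = ≤-respˡ-≈ (-‿inverseʳ x) (+-mono-≤ (- x) x≤y)

  0≤y-x⇒x≤y : ∀ {x y} → 0# ≤ (y - x) → x ≤ y
  0≤y-x⇒x≤y {x} {y} 0≤y-x = ≤-respʳ-≈ (//-rightDividesˡ x y) (≤-respˡ-≈ (+-identityˡ x) (+-mono-≤ x 0≤y-x))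

  x≤0⇒0≤-x : ∀ {x} → x ≤ 0# → 0# ≤ (- x)
  x≤0⇒0≤-x {x} x≤0 = ≤-respʳ-≈ (+-identityˡ (- x)) (x≤y⇒0≤y-x x≤0)

  -x*-x≈x*x : ∀ x → (- x) * (- x) ≈ x * x
  -x*-x≈x*x x = begin
    (- x) * (- x)  ≈⟨ -‿distribˡ-* x (- x) ⟨
    - (x * - x)    ≈⟨ -‿cong (-‿distribʳ-* x x) ⟨
    - (- (x * x))  ≈⟨ -‿involutive (x * x) ⟩
    x * x          ∎

  0≤x*x : ∀ x → 0# ≤ (x * x)
  0≤x*x x with total 0# x
  ... | inj₁ 0≤x = *-nonneg 0≤x 0≤x
  ... | inj₂ x≤0 = ≤-respʳ-≈ (-x*-x≈x*x x) (*-nonneg (x≤0⇒0≤-x x≤0) (x≤0⇒0≤-x x≤0))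

  0≤1 : 0# ≤ 1#
  0≤1 = ≤-respʳ-≈ (*-identityˡ 1#) (0≤x*x 1#)

  +-nonneg : ∀ {x y} → 0# ≤ x → 0# ≤ y → 0# ≤ (x + y)
  +-nonneg {x} {y} 0≤x 0≤y =
    ≤-trans 0≤x (≤-respˡ-≈ (+-identityˡ x) (≤-respʳ-≈ (+-comm y x) (+-mono-≤ x 0≤y)))

  +-nonneg-zeroˡ : ∀ {x y} → 0# ≤ x → 0# ≤ y → x + y ≈ 0# → x ≈ 0#
  +-nonneg-zeroˡ {x} {y} 0≤x 0≤y x+y≈0 =
    antisym (≤-respˡ-≈ (+-identityˡ x) (≤-respʳ-≈ (trans (+-comm y x) x+y≈0) (+-mono-≤ x 0≤y))) 0≤x

  +-nonneg-zeroʳ : ∀ {x y} → 0# ≤ x → 0# ≤ y → x + y ≈ 0# → y ≈ 0#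
  +-nonneg-zeroʳ 0≤x 0≤y x+y≈0 = +-nonneg-zeroˡ 0≤y 0≤x (trans (+-comm _ _) x+y≈0)

  -- If 1 ≤ x then 0 ≤ x (x - 1) ≈ - x, so 1 ≤ x ≤ 0.
  nilpotent⇒≤1 : ∀ x → x * x ≈ 0# → x ≤ 1#
  nilpotent⇒≤1 x x²≈0 with total x 1#
  ... | inj₁ x≤1 = x≤1
  ... | inj₂ 1≤x = ⊥-elim (0≉1 (antisym 0≤1 (≤-trans 1≤x x≤0)))
    where
    x[x-1]≈0-x : x * (x - 1#) ≈ 0# - x
    x[x-1]≈0-x = trans (x[y-z]≈xy-xz x x 1#) (+-cong x²≈0 (-‿cong (*-identityʳ x)))
    x≤0 : x ≤ 0#
    x≤0 = 0≤y-x⇒x≤y (≤-respʳ-≈ x[x-1]≈0-x (*-nonneg (≤-trans 0≤1 1≤x) (x≤y⇒0≤y-x 1≤x)))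

  -- Archimedean property: if s is the supremum of the multiples k x, then s - x
  -- bounds every k x = (k + 1) x - x as well, so s ≤ s - x.
  multiples≤1⇒≤0 : ∀ x → (∀ k → (fromℕ R k * x) ≤ 1#) → x ≤ 0#
  multiples≤1⇒≤0 x bounded = s+x≤s⇒x≤0 (≤-respʳ-≈ (//-rightDividesˡ x s) (+-mono-≤ x s≤s-x))
    where
    Multiple : Carrier → Set c
    Multiple z = Σ ℕ λ k → z ≡ fromℕ R k * x
    supremum : Σ Carrier λ s → (∀ z → Multiple z → z ≤ s) × (∀ b → (∀ z → Multiple z → z ≤ b) → s ≤ b)
    supremum = sup Multiple (fromℕ R 0 * x , 0 , ≡.refl) (1# , λ { _ (k , ≡.refl) → bounded k })
    s : Carrier
    s = proj₁ supremum
    s-x-bound : ∀ z → Multiple z → z ≤ (s - x)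
    s-x-bound _ (k , ≡.refl) =
      ≤-respˡ-≈ (xyx⁻¹≈y x _)
        (+-mono-≤ (- x) (≤-respˡ-≈ (trans (distribʳ x 1# (fromℕ R k)) (+-congʳ (*-identityˡ x)))
          (proj₁ (proj₂ supremum) _ (suc k , ≡.refl))))
    s≤s-x : s ≤ (s - x)
    s≤s-x = proj₂ (proj₂ supremum) (s - x) s-x-bound
    s+x≤s⇒x≤0 : (s + x) ≤ s → x ≤ 0#
    s+x≤s⇒x≤0 p = ≤-respˡ-≈ (xyx⁻¹≈y s x) (≤-respʳ-≈ (-‿inverseʳ s) (+-mono-≤ (- s) p))

  nilpotent⇒≤0 : ∀ x → x * x ≈ 0# → x ≤ 0#
  nilpotent⇒≤0 x x²≈0 = multiples≤1⇒≤0 x λ k →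
    nilpotent⇒≤1 (fromℕ R k * x) (trans (*-interchange _ x _ x) (trans (*-congˡ x²≈0) (zeroʳ _)))

  nilpotent⇒≈0 : ∀ x → x * x ≈ 0# → x ≈ 0#
  nilpotent⇒≈0 x x²≈0 = antisym (nilpotent⇒≤0 x x²≈0)
    (≤-respʳ-≈ (-‿involutive x) (x≤0⇒0≤-x (nilpotent⇒≤0 (- x) (trans (-x*-x≈x*x x) x²≈0))))

  0≤⟨u,u⟩ : ∀ {n} (u : Vec Carrier n) → 0# ≤ dot R u u
  0≤⟨u,u⟩ []      = ≤-refl
  0≤⟨u,u⟩ (x ∷ u) = +-nonneg (0≤x*x x) (0≤⟨u,u⟩ u)

  ⟨u,u⟩≈0⇒u≈0 : ∀ {n} (u : Vec Carrier n) → dot R u u ≈ 0# → ∀ i → lookup u i ≈ 0#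
  ⟨u,u⟩≈0⇒u≈0 (x ∷ u) ⟨u,u⟩≈0 zero    = nilpotent⇒≈0 x (+-nonneg-zeroˡ (0≤x*x x) (0≤⟨u,u⟩ u) ⟨u,u⟩≈0)
  ⟨u,u⟩≈0⇒u≈0 (x ∷ u) ⟨u,u⟩≈0 (suc i) = ⟨u,u⟩≈0⇒u≈0 u (+-nonneg-zeroʳ (0≤x*x x) (0≤⟨u,u⟩ u) ⟨u,u⟩≈0) i

  -- Writing x = z + y with z = x - y turns the identity into a semiring identity.
  [x-y]²+2xy≈x²+y² : ∀ x y → (x - y) * (x - y) + (x * y + x * y) ≈ x * x + y * y
  [x-y]²+2xy≈x²+y² x y = begin
    (x - y) * (x - y) + (x * y + x * y)              ≈⟨ +-congˡ (+-cong (*-congʳ z+y≈x) (*-congʳ z+y≈x)) ⟨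
    z * z + ((z + y) * y + (z + y) * y)              ≈⟨ expand z y ⟩
    (z + y) * (z + y) + y * y                        ≈⟨ +-congʳ (*-cong z+y≈x z+y≈x) ⟩
    x * x + y * y                                    ∎
    where
    z : Carrier
    z = x - y
    z+y≈x : z + y ≈ x
    z+y≈x = //-rightDividesˡ y x
    expand : ∀ z y → z * z + ((z + y) * y + (z + y) * y) ≈ (z + y) * (z + y) + y * y
    expand = solve 2 (λ z y → z :* z :+ ((z :+ y) :* y :+ (z :+ y) :* y) := (z :+ y) :* (z :+ y) :+ y :* y) refl

  ∣u-v∣²+2⟨u,v⟩≈∣u∣²+∣v∣² : ∀ {n} (u v : Vec Carrier n) →
    dot R (zipWith _-_ u v) (zipWith _-_ u v) + (dot R u v + dot R u v) ≈ dot R u u + dot R v v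
  ∣u-v∣²+2⟨u,v⟩≈∣u∣²+∣v∣² []      []      = +-identityˡ _
  ∣u-v∣²+2⟨u,v⟩≈∣u∣²+∣v∣² (x ∷ u) (y ∷ v) = begin
    ((x - y) * (x - y) + dot R u-v u-v) + ((x * y + dot R u v) + (x * y + dot R u v))
      ≈⟨ +-congˡ (interchange _ _ _ _) ⟩
    ((x - y) * (x - y) + dot R u-v u-v) + ((x * y + x * y) + (dot R u v + dot R u v))
      ≈⟨ interchange _ _ _ _ ⟩
    ((x - y) * (x - y) + (x * y + x * y)) + (dot R u-v u-v + (dot R u v + dot R u v))
      ≈⟨ +-cong ([x-y]²+2xy≈x²+y² x y) (∣u-v∣²+2⟨u,v⟩≈∣u∣²+∣v∣² u v) ⟩
    (x * x + y * y) + (dot R u u + dot R v v)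
      ≈⟨ interchange _ _ _ _ ⟩
    (x * x + dot R u u) + (y * y + dot R v v)        ∎
    where u-v = zipWith _-_ u v

  ∑ : ∀ {A : Set} → (A → Carrier) → List A → Carrier
  ∑ f = foldr (λ x acc → f x + acc) 0#

  ∑-cong : ∀ {A : Set} {f g : A → Carrier} {xs} → All (λ x → f x ≈ g x) xs → ∑ f xs ≈ ∑ g xs
  ∑-cong []           = refl
  ∑-cong (fx≈gx ∷ eqs) = +-cong fx≈gx (∑-cong eqs)

  ∑-+ : ∀ {A : Set} (f g : A → Carrier) xs → ∑ (λ x → f x + g x) xs ≈ ∑ f xs + ∑ g xs
  ∑-+ f g []       = sym (+-identityˡ 0#)
  ∑-+ f g (x ∷ xs) = trans (+-congˡ (∑-+ f g xs)) (interchange _ _ _ _)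

  ∑-1 : ∀ {A : Set} (xs : List A) → ∑ (λ _ → 1#) xs ≡ fromℕ R (length xs)
  ∑-1 []       = ≡.refl
  ∑-1 (x ∷ xs) = ≡.cong (1# +_) (∑-1 xs)

  ∑-nonneg : ∀ {A : Set} {f : A → Carrier} {xs} → All (λ x → 0# ≤ f x) xs → 0# ≤ ∑ f xs
  ∑-nonneg []         = ≤-refl
  ∑-nonneg (0≤fx ∷ ps) = +-nonneg 0≤fx (∑-nonneg ps)

  ∑-nonneg-zero : ∀ {A : Set} {f : A → Carrier} {xs} →
    All (λ x → 0# ≤ f x) xs → ∑ f xs ≈ 0# → All (λ x → f x ≈ 0#) xs
  ∑-nonneg-zero []           _   = []
  ∑-nonneg-zero (0≤fx ∷ ps) ∑≈0 =
    +-nonneg-zeroˡ 0≤fx (∑-nonneg ps) ∑≈0 ∷ ∑-nonneg-zero ps (+-nonneg-zeroʳ 0≤fx (∑-nonneg ps) ∑≈0)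

  -- ∑ₚ ∣uₚ - vₚ∣² = ∑ₚ (∣uₚ∣² + ∣vₚ∣²) - 2 ∑ₚ ⟨uₚ,vₚ⟩ = 2m - 2m = 0.
  unit-∑⟨u,v⟩≈length⇒u≈v : ∀ {A : Set} {n} (u v : A → Vec Carrier n) (ps : List A) →
    All (λ p → dot R (u p) (u p) ≈ 1# × dot R (v p) (v p) ≈ 1#) ps →
    ∑ (λ p → dot R (u p) (v p)) ps ≈ fromℕ R (length ps) →
    All (λ p → ∀ i → lookup (u p) i ≈ lookup (v p) i) ps
  unit-∑⟨u,v⟩≈length⇒u≈v {A} {n} u v ps unit ∑≈m =
    All.map (λ {p} ∣u-v∣²≈0 i → x∙y⁻¹≈ε⇒x≈y _ _
              (trans (sym (reflexive (lookup-zipWith _-_ i (u p) (v p)))) (⟨u,u⟩≈0⇒u≈0 (u-v p) ∣u-v∣²≈0 i)))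
      (∑-nonneg-zero (All.tabulate (λ {p} _ → 0≤⟨u,u⟩ (u-v p))) ∑∣u-v∣²≈0)
    where
    u-v : A → Vec Carrier n
    u-v p = zipWith _-_ (u p) (v p)
    ∣u-v∣² ⟨u,v⟩ : A → Carrier
    ∣u-v∣² p = dot R (u-v p) (u-v p)
    ⟨u,v⟩ p = dot R (u p) (v p)
    m : Carrier
    m = fromℕ R (length ps)
    ∑∣u-v∣²≈0 : ∑ ∣u-v∣² ps ≈ 0#
    ∑∣u-v∣²≈0 = +-identityˡ-unique _ (m + m) (begin
      ∑ ∣u-v∣² ps + (m + m)                                ≈⟨ +-congˡ (+-cong ∑≈m ∑≈m) ⟨
      ∑ ∣u-v∣² ps + (∑ ⟨u,v⟩ ps + ∑ ⟨u,v⟩ ps)              ≈⟨ +-congˡ (∑-+ ⟨u,v⟩ ⟨u,v⟩ ps) ⟨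
      ∑ ∣u-v∣² ps + ∑ (λ p → ⟨u,v⟩ p + ⟨u,v⟩ p) ps        ≈⟨ ∑-+ ∣u-v∣² _ ps ⟨
      ∑ (λ p → ∣u-v∣² p + (⟨u,v⟩ p + ⟨u,v⟩ p)) ps         ≈⟨ ∑-cong (All.map (λ {p} (∣u∣²≈1 , ∣v∣²≈1) →
                                                             trans (∣u-v∣²+2⟨u,v⟩≈∣u∣²+∣v∣² (u p) (v p)) (+-cong ∣u∣²≈1 ∣v∣²≈1)) unit) ⟩
      ∑ (λ _ → 1# + 1#) ps                                 ≈⟨ ∑-+ _ _ ps ⟩
      ∑ (λ _ → 1#) ps + ∑ (λ _ → 1#) ps                    ≡⟨ ≡.cong (λ k → k + k) (∑-1 ps) ⟩
      m + m                                                ∎)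

open import Data.Nat using (_+_; _*_; _∸_; _≤_; _≡ᵇ_; _≤ᵇ_; s≤s)
open import Data.Nat.Properties using (+-identityʳ; +-comm; +-assoc; ≤-reflexive; ≡ᵇ⇒≡; ≡⇒≡ᵇ; ≤⇒≤ᵇ)
import Data.Nat.Properties
open import Data.Nat.ListAction using (sum)
open import Algebra.Properties.CommutativeSemigroup Data.Nat.Properties.+-commutativeSemigroup
  using () renaming (interchange to +-interchange)
open import Data.Integer using (+_)
import Data.Integer as ℤ
import Data.Integer.Properties as ℤ
open import Data.Bool using (Bool; true; false; _∧_; T; T?)
open import Data.Bool.Properties using (∧-zeroʳ; ∧-identityʳ; T-∧; T-≡)
import Data.Bool as Bool
open import Data.Fin.Subset using (Subset; _∩_; ∣_∣; ⁅_⁆)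
open import Data.Fin.Subset.Properties using (∣⁅x⁆∣≡1)
open import Data.Vec.Relation.Binary.Pointwise.Extensional using (ext; Pointwise-≡⇒≡)
open import Data.List.Properties using (filter-++; filter-≐; map-tabulate)
open import Data.List.Membership.Propositional using (_∈_)
open import Data.List.Membership.Propositional.Properties using (∈-++⁺ˡ; ∈-++⁺ʳ; ∈-map⁺; ∈-filter⁺)
open import Data.List.Relation.Unary.Any using (here; there)
open import Data.List.Relation.Unary.All.Properties using (all⁺; all⁻; tabulate⁺; tabulate⁻; all-filter)
open import Function using (_∘_; id; Equivalence)
open import Relation.Nullary using (Dec; does; yes; no)
open import Relation.Binary.Definitions using (DecidableEquality)
open ≡ using (refl; sym; trans; cong; cong₂; subst)
open ≡.≡-Reasoning

-- Lists and subsets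

filter-T-cong : ∀ {A : Set} {f g : A → Bool} → (∀ x → f x ≡ g x) →
  ∀ xs → filter (λ x → T? (f x)) xs ≡ filter (λ x → T? (g x)) xs
filter-T-cong {f = f} {g} f≗g = filter-≐ (λ x → T? (f x)) (λ x → T? (g x))
  ((λ {x} → subst T (f≗g x)) , (λ {x} → subst T (sym (f≗g x))))

filter-false : ∀ {A : Set} (xs : List A) → filter (λ _ → T? false) xs ≡ []
filter-false []       = refl
filter-false (x ∷ xs) = filter-false xs

filter-map : ∀ {A B : Set} (g : A → B) (f : B → Bool) xs →
  filter (λ z → T? (f z)) (map g xs) ≡ map g (filter (λ x → T? (f (g x))) xs)
filter-map g f []       = refl
filter-map g f (x ∷ xs) with f (g x)
... | true  = cong (g x ∷_) (filter-map g f xs)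
... | false = filter-map g f xs

filter-filter : ∀ {A : Set} (b f : A → Bool) xs →
  filter (λ x → T? (f x)) (filter (λ x → T? (b x)) xs) ≡ filter (λ x → T? (b x ∧ f x)) xs
filter-filter b f []       = refl
filter-filter b f (x ∷ xs) with b x
... | false = filter-filter b f xs
... | true with f x
...   | true  = cong (x ∷_) (filter-filter b f xs)
...   | false = filter-filter b f xs

module _ {A : Set} (b₁ b₂ : A → Bool) (m : A × A → Bool) where
  private
    m? : ∀ p → Dec (T (m p))
    m? p = T? (m p)
    q? : ∀ p → Dec (T (b₁ (proj₁ p) ∧ (b₂ (proj₂ p) ∧ m p)))
    q? p = T? (b₁ (proj₁ p) ∧ (b₂ (proj₂ p) ∧ m p))

  filter-pairs : ∀ xs ys →
    filter m? (pairs (filter (λ x → T? (b₁ x)) xs) (filter (λ y → T? (b₂ y)) ys)) ≡ filter q? (pairs xs ys)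
  filter-pairs []       ys = refl
  filter-pairs (x ∷ xs) ys with b₁ x in b₁x
  ... | true = begin
    filter m? (map (x ,_) ys′ ++ pairs xs′ ys′)             ≡⟨ filter-++ m? (map (x ,_) ys′) _ ⟩
    filter m? (map (x ,_) ys′) ++ filter m? (pairs xs′ ys′) ≡⟨ cong₂ _++_ row (filter-pairs xs ys) ⟩
    filter q? (map (x ,_) ys) ++ filter q? (pairs xs ys)     ≡⟨ filter-++ q? (map (x ,_) ys) _ ⟨
    filter q? (pairs (x ∷ xs) ys)                            ∎
    where
    xs′ ys′ : List A
    xs′ = filter (λ x → T? (b₁ x)) xs
    ys′ = filter (λ y → T? (b₂ y)) ys
    row : filter m? (map (x ,_) ys′) ≡ filter q? (map (x ,_) ys)
    row = begin
      filter m? (map (x ,_) ys′)                                    ≡⟨ filter-map (x ,_) m ys′ ⟩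
      map (x ,_) (filter (λ y → T? (m (x , y))) ys′)                 ≡⟨ cong (map (x ,_)) (filter-filter b₂ (m ∘ (x ,_)) ys) ⟩
      map (x ,_) (filter (λ y → T? (true ∧ (b₂ y ∧ m (x , y)))) ys)  ≡⟨ cong (λ c → map (x ,_) (filter (λ y → T? (c ∧ (b₂ y ∧ m (x , y)))) ys)) b₁x ⟨
      map (x ,_) (filter (λ y → T? (b₁ x ∧ (b₂ y ∧ m (x , y)))) ys)  ≡⟨ filter-map (x ,_) _ ys ⟨
      filter q? (map (x ,_) ys)                                       ∎
  ... | false = begin
    filter m? (pairs xs′ ys′)                              ≡⟨ filter-pairs xs ys ⟩
    filter q? (pairs xs ys)                                ≡⟨ cong (_++ filter q? (pairs xs ys)) row ⟨
    filter q? (map (x ,_) ys) ++ filter q? (pairs xs ys)   ≡⟨ filter-++ q? (map (x ,_) ys) _ ⟨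
    filter q? (pairs (x ∷ xs) ys)                          ∎
    where
    xs′ ys′ : List A
    xs′ = filter (λ x → T? (b₁ x)) xs
    ys′ = filter (λ y → T? (b₂ y)) ys
    row : filter q? (map (x ,_) ys) ≡ []
    row = begin
      filter q? (map (x ,_) ys)                                       ≡⟨ filter-map (x ,_) _ ys ⟩
      map (x ,_) (filter (λ y → T? (b₁ x ∧ (b₂ y ∧ m (x , y)))) ys)  ≡⟨ cong (λ c → map (x ,_) (filter (λ y → T? (c ∧ (b₂ y ∧ m (x , y)))) ys)) b₁x ⟩
      map (x ,_) (filter (λ _ → T? false) ys)                         ≡⟨ cong (map (x ,_)) (filter-false ys) ⟩
      []                                                              ∎

∈-pairs : ∀ {A : Set} {x y : A} {xs ys} → x ∈ xs → y ∈ ys → (x , y) ∈ pairs xs ys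
∈-pairs {x = x} {ys = ys} (here refl) y∈ys = ∈-++⁺ˡ (∈-map⁺ (x ,_) y∈ys)
∈-pairs {xs = x′ ∷ _} {ys} (there x∈xs) y∈ys = ∈-++⁺ʳ (map (x′ ,_) ys) (∈-pairs x∈xs y∈ys)

_≟_ : ∀ {n} → DecidableEquality (Subset n)
_≟_ = ≡-dec Bool._≟_

∈-allSubsets : ∀ {n} (S : Subset n) → S ∈ allSubsets n
∈-allSubsets []            = here refl
∈-allSubsets {suc n} (true ∷ S)  = ∈-++⁺ˡ (∈-map⁺ (true ∷_) (∈-allSubsets S))
∈-allSubsets {suc n} (false ∷ S) = ∈-++⁺ʳ (map (true ∷_) (allSubsets n)) (∈-map⁺ (false ∷_) (∈-allSubsets S))

filter-≟-allSubsets : ∀ {n} (S : Subset n) → filter (λ X → T? (does (X ≟ S))) (allSubsets n) ≡ S ∷ []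
filter-≟-allSubsets []                = refl
filter-≟-allSubsets {suc n} (b ∷ S) = begin
  filter S? (map (true ∷_) all ++ map (false ∷_) all)                ≡⟨ filter-++ S? (map (true ∷_) all) _ ⟩
  filter S? (map (true ∷_) all) ++ filter S? (map (false ∷_) all)    ≡⟨ cong₂ _++_ (filter-map (true ∷_) _ all) (filter-map (false ∷_) _ all) ⟩
  map (true ∷_) (filter (λ X → T? (does (true Bool.≟ b) ∧ does (X ≟ S))) all)
    ++ map (false ∷_) (filter (λ X → T? (does (false Bool.≟ b) ∧ does (X ≟ S))) all) ≡⟨ rows b ⟩
  (b ∷ S) ∷ []                                                         ∎
  where
  all : List (Subset n)
  all = allSubsets n
  S? : ∀ X → Dec (T (does (X ≟ (b ∷ S))))
  S? = λ X → T? (does (X ≟ (b ∷ S)))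
  rows : ∀ b → map (true ∷_) (filter (λ X → T? (does (true Bool.≟ b) ∧ does (X ≟ S))) all)
                 ++ map (false ∷_) (filter (λ X → T? (does (false Bool.≟ b) ∧ does (X ≟ S))) all) ≡ (b ∷ S) ∷ []
  rows true  = cong₂ (λ xs ys → map (true ∷_) xs ++ map (false ∷_) ys) (filter-≟-allSubsets S) (filter-false all)
  rows false = cong₂ (λ xs ys → map (true ∷_) xs ++ map (false ∷_) ys) (filter-false all) (filter-≟-allSubsets S)

-- Monomials and their coefficients

bitSum : Bool → Bool → Fin 3
bitSum false false = zero
bitSum true  false = suc zero
bitSum false true  = suc zero
bitSum true  true  = suc (suc zero)

toℕ-bitSum : ∀ s t → toℕ (bitSum s t) ≡ b2n s + b2n t
toℕ-bitSum false false = refl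
toℕ-bitSum true  false = refl
toℕ-bitSum false true  = refl
toℕ-bitSum true  true  = refl

-- y^(exponent S T) = y^S y^T
exponent : ∀ {N} → Subset N → Subset N → Fin N → Fin 3
exponent S T h = bitSum (lookup S h) (lookup T h)

weight-exponent : ∀ {N} (S T : Subset N) → weight (exponent S T) ≡ ∣ S ∣ + ∣ T ∣
weight-exponent S U = trans (cong sum (map-tabulate id (λ h → toℕ (exponent S U h)))) (sum-exponent S U)
  where
  ∣∷∣ : ∀ {n} b (S : Subset n) → ∣ b ∷ S ∣ ≡ b2n b + ∣ S ∣
  ∣∷∣ true  S = refl
  ∣∷∣ false S = refl
  sum-exponent : ∀ {n} (S U : Subset n) → sum (tabulate (λ h → toℕ (exponent S U h))) ≡ ∣ S ∣ + ∣ U ∣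
  sum-exponent []      []      = refl
  sum-exponent (s ∷ S) (u ∷ U) = begin
    toℕ (bitSum s u) + sum (tabulate (λ h → toℕ (exponent S U h)))  ≡⟨ cong₂ _+_ (toℕ-bitSum s u) (sum-exponent S U) ⟩
    (b2n s + b2n u) + (∣ S ∣ + ∣ U ∣)                                ≡⟨ +-interchange (b2n s) (b2n u) ∣ S ∣ ∣ U ∣ ⟩
    (b2n s + ∣ S ∣) + (b2n u + ∣ U ∣)                                ≡⟨ cong₂ _+_ (∣∷∣ s S) (∣∷∣ u U) ⟨
    ∣ s ∷ S ∣ + ∣ u ∷ U ∣                                            ∎

monoEq-exponent⁻ : ∀ {N} (X Y S U : Subset N) → T (monoEq X Y (exponent S U)) →
  ∀ h → b2n (lookup X h) + b2n (lookup Y h) ≡ b2n (lookup S h) + b2n (lookup U h)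
monoEq-exponent⁻ {N} X Y S U sol h =
  trans (≡ᵇ⇒≡ _ _ (tabulate⁻ (all⁺ _ (allFin N) sol) h)) (toℕ-bitSum (lookup S h) (lookup U h))

monoEq-exponent⁺ : ∀ {N} (S U : Subset N) → T (monoEq S U (exponent S U))
monoEq-exponent⁺ {N} S U = all⁻ _ (tabulate⁺ λ h → ≡⇒≡ᵇ _ _ (sym (toℕ-bitSum (lookup S h) (lookup U h))))

b2n-+-double : ∀ x y s → b2n x + b2n y ≡ b2n s + b2n s → x ≡ s × y ≡ s
b2n-+-double false false false _ = refl , refl
b2n-+-double true  true  true  _ = refl , refl
b2n-+-double false false true  ()
b2n-+-double false true  false ()
b2n-+-double false true  true  ()
b2n-+-double true  false false ()
b2n-+-double true  false true  ()
b2n-+-double true  true  false ()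

monoEq-double⁻ : ∀ {N} (X Y S : Subset N) → T (monoEq X Y (exponent S S)) → X ≡ S × Y ≡ S
monoEq-double⁻ X Y S sol =
  Pointwise-≡⇒≡ (ext (proj₁ ∘ agree)) , Pointwise-≡⇒≡ (ext (proj₂ ∘ agree))
  where
  agree : ∀ h → lookup X h ≡ lookup S h × lookup Y h ≡ lookup S h
  agree h = b2n-+-double _ _ _ (monoEq-exponent⁻ X Y S S sol h)

∧-agree : ∀ x y s u l → b2n x + b2n y ≡ b2n s + b2n u → s ∧ l ≡ u ∧ l → x ∧ l ≡ s ∧ l × y ∧ l ≡ s ∧ l
∧-agree x y s u false _ _ = trans (∧-zeroʳ x) (sym (∧-zeroʳ s)) , trans (∧-zeroʳ y) (sym (∧-zeroʳ s))
∧-agree x y s u true x+y≡s+u s≡u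
  rewrite ∧-identityʳ x | ∧-identityʳ y | ∧-identityʳ s | ∧-identityʳ u =
  b2n-+-double x y s (trans x+y≡s+u (cong (λ u → b2n s + b2n u) (sym s≡u)))

monoEq-exponent-∩ : ∀ {N} {L : Subset N} (X Y S U : Subset N) → S ∩ L ≡ U ∩ L → T (monoEq X Y (exponent S U)) →
  X ∩ L ≡ S ∩ L × Y ∩ L ≡ S ∩ L
monoEq-exponent-∩ {L = L} X Y S U S∩L≡U∩L sol =
  Pointwise-≡⇒≡ (ext (proj₁ ∘ agree)) , Pointwise-≡⇒≡ (ext (proj₂ ∘ agree))
  where
  ∩-lookup : ∀ Z h → lookup (Z ∩ L) h ≡ lookup Z h ∧ lookup L h
  ∩-lookup Z h = lookup-zipWith _∧_ h Z L
  agree : ∀ h → lookup (X ∩ L) h ≡ lookup (S ∩ L) h × lookup (Y ∩ L) h ≡ lookup (S ∩ L) h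
  agree h with ∧-agree (lookup X h) (lookup Y h) (lookup S h) (lookup U h) (lookup L h) (monoEq-exponent⁻ X Y S U sol h)
                 (trans (sym (∩-lookup S h)) (trans (cong (λ Z → lookup Z h) S∩L≡U∩L) (∩-lookup U h)))
  ... | x≡s , y≡s = trans (∩-lookup X h) (trans x≡s (sym (∩-lookup S h))) ,
                    trans (∩-lookup Y h) (trans y≡s (sym (∩-lookup S h)))

∧-guarded-cong : ∀ {a a′ b b′} c → (T c → a ≡ a′ × b ≡ b′) → a ∧ (b ∧ c) ≡ a′ ∧ (b′ ∧ c)
∧-guarded-cong {a} {a′} {b} {b′} false _ =
  trans (cong (a ∧_) (∧-zeroʳ b)) (trans (∧-zeroʳ a) (sym (trans (cong (a′ ∧_) (∧-zeroʳ b′)) (∧-zeroʳ a′))))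
∧-guarded-cong true eqs = cong₂ (λ a b → a ∧ (b ∧ true)) (proj₁ (eqs _)) (proj₂ (eqs _))

∧-guarded-false : ∀ a b c → (T c → a ∧ b ≡ false) → a ∧ (b ∧ c) ≡ false
∧-guarded-false a b false _     = trans (cong (a ∧_) (∧-zeroʳ b)) (∧-zeroʳ a)
∧-guarded-false a b true  a∧b≡f = trans (cong (a ∧_) (∧-identityʳ b)) (a∧b≡f _)

module _ {N : ℕ} where

  Poly : (Subset N → Bool) → List (Subset N)
  Poly b = filter (λ X → T? (b X)) (allSubsets N)

  coeffProd-filter : ∀ (b₁ b₂ : Subset N → Bool) α → coeffProd (Poly b₁) (Poly b₂) α ≡
    length (filter (λ p → T? (b₁ (proj₁ p) ∧ (b₂ (proj₂ p) ∧ monoEq (proj₁ p) (proj₂ p) α))) (pairs (allSubsets N) (allSubsets N)))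
  coeffProd-filter b₁ b₂ α = cong length (filter-pairs b₁ b₂ _ (allSubsets N) (allSubsets N))

  length-𝒫 : ∀ d α → length (𝒫 {N} d α) ≡ coeffProd (Poly (λ X → ∣ X ∣ ≡ᵇ d)) (Poly (λ X → ∣ X ∣ ≡ᵇ d)) α
  length-𝒫 d α = sym (coeffProd-filter _ _ α)

  coeffProd-cong : ∀ {b₁ b₂ b₁′ b₂′ : Subset N → Bool} α →
    (∀ X Y → T (monoEq X Y α) → b₁ X ≡ b₁′ X × b₂ Y ≡ b₂′ Y) →
    coeffProd (Poly b₁) (Poly b₂) α ≡ coeffProd (Poly b₁′) (Poly b₂′) α
  coeffProd-cong {b₁} {b₂} {b₁′} {b₂′} α agree = begin
    coeffProd (Poly b₁) (Poly b₂) α    ≡⟨ coeffProd-filter b₁ b₂ α ⟩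
    length (filter _ all²)             ≡⟨ cong length (filter-T-cong (λ (X , Y) → ∧-guarded-cong (monoEq X Y α) (agree X Y)) all²) ⟩
    length (filter _ all²)             ≡⟨ coeffProd-filter b₁′ b₂′ α ⟨
    coeffProd (Poly b₁′) (Poly b₂′) α  ∎
    where
    all² : List (Subset N × Subset N)
    all² = pairs (allSubsets N) (allSubsets N)

  coeffProd-vanish : ∀ {b₁ b₂ : Subset N → Bool} α →
    (∀ X Y → T (monoEq X Y α) → b₁ X ∧ b₂ Y ≡ false) → coeffProd (Poly b₁) (Poly b₂) α ≡ 0
  coeffProd-vanish {b₁} {b₂} α disjoint = begin
    coeffProd (Poly b₁) (Poly b₂) α  ≡⟨ coeffProd-filter b₁ b₂ α ⟩
    length (filter _ all²)           ≡⟨ cong length (filter-T-cong (λ (X , Y) → ∧-guarded-false (b₁ X) (b₂ Y) _ (disjoint X Y)) all²) ⟩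
    length (filter (λ _ → T? false) all²) ≡⟨ cong length (filter-false all²) ⟩
    0                                ∎
    where
    all² : List (Subset N × Subset N)
    all² = pairs (allSubsets N) (allSubsets N)

  𝒫-double : ∀ d (S : Subset N) → ∣ S ∣ ≡ d → 𝒫 d (exponent S S) ≡ (S , S) ∷ []
  𝒫-double d S ∣S∣≡d = begin
    𝒫 d (exponent S S)                                                 ≡⟨ filter-T-cong (λ p → onlySS (proj₁ p) (proj₂ p)) all² ⟩
    filter (λ p → T? (isS (proj₁ p) ∧ (isS (proj₂ p) ∧ true))) all²   ≡⟨ filter-pairs isS isS (λ _ → true) (allSubsets N) (allSubsets N) ⟨
    filter (λ _ → T? true) (pairs (Poly isS) (Poly isS))               ≡⟨ cong (λ xs → filter (λ _ → T? true) (pairs xs xs)) (filter-≟-allSubsets S) ⟩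
    (S , S) ∷ []                                                        ∎
    where
    all² : List (Subset N × Subset N)
    all² = pairs (allSubsets N) (allSubsets N)
    isS : Subset N → Bool
    isS X = does (X ≟ S)
    sizes : Subset N → Subset N → Bool
    sizes X Y = (∣ X ∣ ≡ᵇ d) ∧ ((∣ Y ∣ ≡ᵇ d) ∧ monoEq X Y (exponent S S))
    onlySS : ∀ X Y → sizes X Y ≡ isS X ∧ (isS Y ∧ true)
    onlySS X Y with X ≟ S | Y ≟ S
    ... | yes refl | yes refl = Equivalence.to T-≡
      (Equivalence.from T-∧ (≡⇒≡ᵇ _ _ ∣S∣≡d , Equivalence.from T-∧ (≡⇒≡ᵇ _ _ ∣S∣≡d , monoEq-exponent⁺ S S)))
    ... | no X≢S   | _        = ∧-guarded-false (∣ X ∣ ≡ᵇ d) (∣ Y ∣ ≡ᵇ d) _ (λ sol → ⊥-elim (X≢S (proj₁ (monoEq-double⁻ X Y S sol))))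
    ... | yes _    | no Y≢S   = ∧-guarded-false (∣ X ∣ ≡ᵇ d) (∣ Y ∣ ≡ᵇ d) _ (λ sol → ⊥-elim (Y≢S (proj₂ (monoEq-double⁻ X Y S sol))))

-- The matroid and ΔM{e,f}

m+1+0≡1+m : ∀ m → m + 1 + 0 ≡ suc m
m+1+0≡1+m m = trans (+-identityʳ (m + 1)) (+-comm m 1)

1+m≤ᵇ1+n≡m≤ᵇn : ∀ m n → (suc m ≤ᵇ suc n) ≡ (m ≤ᵇ n)
1+m≤ᵇ1+n≡m≤ᵇn zero    n = refl
1+m≤ᵇ1+n≡m≤ᵇn (suc m) n = refl

n≡ᵇ1+n : ∀ n → (n ≡ᵇ suc n) ≡ false
n≡ᵇ1+n zero    = refl
n≡ᵇ1+n (suc n) = n≡ᵇ1+n n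

module _ (l a : ℕ) (X : Subset (l + a)) where

  isBasis-e : ∀ d → isBasis (suc d) l a X true false ≡ (∣ X ∣ ≡ᵇ d) ∧ (∣ X ∩ Lset l a ∣ ≤ᵇ 1)
  isBasis-e d = trans (cong₂ (λ m k → (m ≡ᵇ suc d) ∧ (k ≤ᵇ 2)) (m+1+0≡1+m ∣ X ∣) (m+1+0≡1+m ∣ X ∩ Lset l a ∣))
                      (cong ((∣ X ∣ ≡ᵇ d) ∧_) (1+m≤ᵇ1+n≡m≤ᵇn ∣ X ∩ Lset l a ∣ 1))

  isBasis-f≡isBasis-e : ∀ r → isBasis r l a X false true ≡ isBasis r l a X true false
  isBasis-f≡isBasis-e r = cong₂ (λ m k → (m ≡ᵇ r) ∧ (k ≤ᵇ 2)) (m+0+1≡m+1+0 ∣ X ∣) (m+0+1≡m+1+0 ∣ X ∩ Lset l a ∣)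
    where
    m+0+1≡m+1+0 : ∀ m → m + 0 + 1 ≡ m + 1 + 0
    m+0+1≡m+1+0 m = trans (cong (_+ 1) (+-identityʳ m)) (sym (+-identityʳ (m + 1)))

  isBasis-ef : ∀ r → 1 ≤ ∣ X ∩ Lset l a ∣ → isBasis r l a X true true ≡ false
  isBasis-ef r 1≤∣X∩L∣ = trans (cong (λ k → (∣ X ∣ + 1 + 1 ≡ᵇ r) ∧ (k ≤ᵇ 2)) (m+1+1≡2+m ∣ X ∩ Lset l a ∣))
                               (3+k≰ᵇ2 _ 1≤∣X∩L∣)
    where
    m+1+1≡2+m : ∀ m → m + 1 + 1 ≡ suc (suc m)
    m+1+1≡2+m m = trans (+-assoc m 1 1) (+-comm m 2)
    3+k≰ᵇ2 : ∀ {b} k → 1 ≤ k → b ∧ (suc (suc k) ≤ᵇ 2) ≡ false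
    3+k≰ᵇ2 {b} (suc k) _ = ∧-zeroʳ b

  isBasis-∅ : ∀ d → ∣ X ∣ ≡ d → isBasis (suc d) l a X false false ≡ false
  isBasis-∅ d ∣X∣≡d = cong (_∧ (∣ X ∩ Lset l a ∣ + 0 + 0 ≤ᵇ 2))
    (trans (cong (λ m → m + 0 + 0 ≡ᵇ suc d) ∣X∣≡d) (trans (cong (_≡ᵇ suc d) (trans (+-identityʳ (d + 0)) (+-identityʳ d))) (n≡ᵇ1+n d)))

module _ (d l a : ℕ) where
  private
    L : Subset (l + a)
    L = Lset l a
    basis : Bool → Bool → Subset (l + a) → Bool
    basis be bf X = isBasis (suc d) l a X be bf

  light-basis-e : ∀ X → ∣ X ∩ L ∣ ≡ 1 → basis true false X ≡ (∣ X ∣ ≡ᵇ d)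
  light-basis-e X ∣X∩L∣≡1 =
    trans (isBasis-e l a X d) (trans (cong (λ k → (∣ X ∣ ≡ᵇ d) ∧ (k ≤ᵇ 1)) ∣X∩L∣≡1) (∧-identityʳ _))

  coeffΔM-double : ∀ S → ∣ S ∣ ≡ d → coeffΔM (suc d) l a (exponent S S) ≡ + b2n (∣ S ∩ L ∣ ≤ᵇ 1)
  coeffΔM-double S ∣S∣≡d =
    trans (cong₂ (λ m k → + m ℤ.- + k) e/f ef/∅) (ℤ.+-identityʳ _)
    where
    α : Fin (l + a) → Fin 3
    α = exponent S S
    e-basis : ∀ X Y → T (monoEq X Y α) → basis true false X ≡ (∣ X ∣ ≡ᵇ d) ∧ (∣ S ∩ L ∣ ≤ᵇ 1)
    e-basis X Y sol with refl ← proj₁ (monoEq-double⁻ X Y S sol) = isBasis-e l a S d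
    f-basis : ∀ X Y → T (monoEq X Y α) → basis false true Y ≡ (∣ Y ∣ ≡ᵇ d) ∧ (∣ S ∩ L ∣ ≤ᵇ 1)
    f-basis X Y sol with refl ← proj₂ (monoEq-double⁻ X Y S sol) = trans (isBasis-f≡isBasis-e l a S (suc d)) (isBasis-e l a S d)
    e/f : coeffProd (Mpart (suc d) l a true false) (Mpart (suc d) l a false true) α ≡ b2n (∣ S ∩ L ∣ ≤ᵇ 1)
    e/f with ∣ S ∩ L ∣ ≤ᵇ 1 in S-light
    ... | true = begin
      coeffProd (Mpart (suc d) l a true false) (Mpart (suc d) l a false true) α
        ≡⟨ coeffProd-cong α (λ X Y sol → trans (e-basis X Y sol) (trans (cong (_ ∧_) S-light) (∧-identityʳ _)) ,
                                          trans (f-basis X Y sol) (trans (cong (_ ∧_) S-light) (∧-identityʳ _))) ⟩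
      coeffProd (Poly (λ X → ∣ X ∣ ≡ᵇ d)) (Poly (λ X → ∣ X ∣ ≡ᵇ d)) α
        ≡⟨ length-𝒫 d α ⟨
      length (𝒫 d α)
        ≡⟨ cong length (𝒫-double d S ∣S∣≡d) ⟩
      1 ∎
    ... | false = coeffProd-vanish α (λ X Y sol →
      cong (_∧ basis false true Y) (trans (e-basis X Y sol) (trans (cong (_ ∧_) S-light) (∧-zeroʳ _))))
    ef/∅ : coeffProd (Mpart (suc d) l a true true) (Mpart (suc d) l a false false) α ≡ 0
    ef/∅ = coeffProd-vanish α (λ X Y sol → trans (cong (basis true true X ∧_) (∅-basis X Y sol)) (∧-zeroʳ _))
      where
      ∅-basis : ∀ X Y → T (monoEq X Y α) → basis false false Y ≡ false
      ∅-basis X Y sol with refl ← proj₂ (monoEq-double⁻ X Y S sol) = isBasis-∅ l a S d ∣S∣≡d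

  coeffΔM-light : ∀ S U → S ∩ L ≡ U ∩ L → ∣ S ∩ L ∣ ≡ 1 →
    coeffΔM (suc d) l a (exponent S U) ≡ + length (𝒫 d (exponent S U))
  coeffΔM-light S U S∩L≡U∩L ∣S∩L∣≡1 =
    trans (cong₂ (λ m k → + m ℤ.- + k) e/f ef/∅) (ℤ.+-identityʳ _)
    where
    α : Fin (l + a) → Fin 3
    α = exponent S U
    light : ∀ X Y → T (monoEq X Y α) → ∣ X ∩ L ∣ ≡ 1 × ∣ Y ∩ L ∣ ≡ 1
    light X Y sol with X∩L≡S∩L , Y∩L≡S∩L ← monoEq-exponent-∩ X Y S U S∩L≡U∩L sol =
      trans (cong ∣_∣ X∩L≡S∩L) ∣S∩L∣≡1 , trans (cong ∣_∣ Y∩L≡S∩L) ∣S∩L∣≡1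
    e/f : coeffProd (Mpart (suc d) l a true false) (Mpart (suc d) l a false true) α ≡ length (𝒫 d α)
    e/f = trans (coeffProd-cong α (λ X Y sol →
                   light-basis-e X (proj₁ (light X Y sol)) ,
                   trans (isBasis-f≡isBasis-e l a Y (suc d)) (light-basis-e Y (proj₂ (light X Y sol)))))
                (sym (length-𝒫 d α))
    ef/∅ : coeffProd (Mpart (suc d) l a true true) (Mpart (suc d) l a false false) α ≡ 0
    ef/∅ = coeffProd-vanish α (λ X Y sol →
      cong (_∧ basis false false Y) (isBasis-ef l a X (suc d) (≤-reflexive (sym (proj₁ (light X Y sol))))))

module _ {c ℓ₁ ℓ₂} (R : RealField c ℓ₁ ℓ₂) (d l a : ℕ) {n : ℕ}
  (cv : Subset (l + a) → Vec (RealField.Carrier R) n)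
  (hyp : ∀ α → weight α ≡ 2 * d → RealField._≈_ R (sum𝒫 R d cv α) (fromℤ R (coeffΔM (suc d) l a α))) where
  open RealField R using (Carrier; _≈_; 0#; 1#; reflexive) renaming (trans to ≈-trans; +-identityʳ to +ᴿ-identityʳ)
  open OrderedFieldProperties R using (∑; ⟨u,u⟩≈0⇒u≈0; unit-∑⟨u,v⟩≈length⇒u≈v)
  private
    L : Subset (l + a)
    L = Lset l a
    ⟨c,c⟩ : Subset (l + a) × Subset (l + a) → Carrier
    ⟨c,c⟩ (X , Y) = dot R (cv X) (cv Y)

  hyp-exponent : ∀ S U → ∣ S ∣ ≡ d → ∣ U ∣ ≡ d → ∑ ⟨c,c⟩ (𝒫 d (exponent S U)) ≈ fromℤ R (coeffΔM (suc d) l a (exponent S U))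
  hyp-exponent S U ∣S∣≡d ∣U∣≡d =
    hyp (exponent S U) (trans (weight-exponent S U) (cong₂ _+_ ∣S∣≡d (trans ∣U∣≡d (sym (+-identityʳ d)))))

  ∣c∣² : ∀ S → ∣ S ∣ ≡ d → dot R (cv S) (cv S) ≈ fromℕ R (b2n (∣ S ∩ L ∣ ≤ᵇ 1))
  ∣c∣² S ∣S∣≡d = ≈-trans (RealField.sym R (+ᴿ-identityʳ _))
    (≈-trans (reflexive (cong (∑ ⟨c,c⟩) (sym (𝒫-double d S ∣S∣≡d))))
    (≈-trans (hyp-exponent S S ∣S∣≡d ∣S∣≡d)
    (reflexive (cong (fromℤ R) (coeffΔM-double d l a S ∣S∣≡d)))))

  ∣c∣²≈1 : ∀ S → ∣ S ∣ ≡ d → ∣ S ∩ L ∣ ≤ 1 → dot R (cv S) (cv S) ≈ 1#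
  ∣c∣²≈1 S ∣S∣≡d light =
    ≈-trans (∣c∣² S ∣S∣≡d) (≈-trans (reflexive (cong (fromℕ R ∘ b2n) (Equivalence.to T-≡ (≤⇒≤ᵇ light)))) (+ᴿ-identityʳ 1#))

  c≈0 : ∀ S → ∣ S ∣ ≡ d → 2 ≤ ∣ S ∩ L ∣ → ∀ i → lookup (cv S) i ≈ 0#
  c≈0 S ∣S∣≡d heavy = ⟨u,u⟩≈0⇒u≈0 (cv S) (≈-trans (∣c∣² S ∣S∣≡d) (reflexive (cong (fromℕ R ∘ b2n) (2≤k⇒k≰ᵇ1 heavy))))
    where
    2≤k⇒k≰ᵇ1 : ∀ {k} → 2 ≤ k → (k ≤ᵇ 1) ≡ false
    2≤k⇒k≰ᵇ1 (s≤s (s≤s _)) = refl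

  c≈c : ∀ S U → ∣ S ∣ ≡ d → ∣ U ∣ ≡ d → S ∩ L ≡ U ∩ L → ∣ S ∩ L ∣ ≡ 1 →
    ∀ i → lookup (cv S) i ≈ lookup (cv U) i
  c≈c S U ∣S∣≡d ∣U∣≡d S∩L≡U∩L ∣S∩L∣≡1 =
    All.lookup (unit-∑⟨u,v⟩≈length⇒u≈v (cv ∘ proj₁) (cv ∘ proj₂) ps (All.map unit (all-filter _ all²)) ∑≈length)
               (∈-filter⁺ _ (∈-pairs (∈-allSubsets S) (∈-allSubsets U))
                            (Equivalence.from T-∧ (≡⇒≡ᵇ _ _ ∣S∣≡d , Equivalence.from T-∧ (≡⇒≡ᵇ _ _ ∣U∣≡d , monoEq-exponent⁺ S U))))
    where
    all² ps : List (Subset (l + a) × Subset (l + a))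
    all² = pairs (allSubsets (l + a)) (allSubsets (l + a))
    ps = 𝒫 d (exponent S U)
    ∑≈length : ∑ ⟨c,c⟩ ps ≈ fromℕ R (length ps)
    ∑≈length = ≈-trans (hyp-exponent S U ∣S∣≡d ∣U∣≡d) (reflexive (cong (fromℤ R) (coeffΔM-light d l a S U S∩L≡U∩L ∣S∩L∣≡1)))
    light : ∀ X → X ∩ L ≡ S ∩ L → ∣ X ∩ L ∣ ≤ 1
    light X X∩L≡S∩L = ≤-reflexive (trans (cong ∣_∣ X∩L≡S∩L) ∣S∩L∣≡1)
    unit : ∀ {p} → T ((∣ proj₁ p ∣ ≡ᵇ d) ∧ ((∣ proj₂ p ∣ ≡ᵇ d) ∧ monoEq (proj₁ p) (proj₂ p) (exponent S U))) →
      dot R (cv (proj₁ p)) (cv (proj₁ p)) ≈ 1# × dot R (cv (proj₂ p)) (cv (proj₂ p)) ≈ 1#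
    unit {X , Y} inP with ∣X∣≡ᵇd , rest ← Equivalence.to T-∧ inP
                      with ∣Y∣≡ᵇd , sol ← Equivalence.to T-∧ rest
                      with X∩L≡S∩L , Y∩L≡S∩L ← monoEq-exponent-∩ X Y S U S∩L≡U∩L sol =
      ∣c∣²≈1 X (≡ᵇ⇒≡ _ _ ∣X∣≡ᵇd) (light X X∩L≡S∩L) , ∣c∣²≈1 Y (≡ᵇ⇒≡ _ _ ∣Y∣≡ᵇd) (light Y Y∩L≡S∩L)

lemma3p2 : ∀ {c ℓ₁ ℓ₂} (R : RealField c ℓ₁ ℓ₂) (r l a n : ℕ) →
    3 ≤ r → 1 ≤ l → r ∸ 2 ≤ a →
    (cv : Subset (l + a) → Vec (RealField.Carrier R) n) →
    (∀ (α : Fin (l + a) → Fin 3) → weight α ≡ 2 * (r ∸ 1) →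
      RealField._≈_ R (sum𝒫 R (r ∸ 1) cv α) (fromℤ R (coeffΔM r l a α))) →
    (∀ (S : Subset (l + a)) → ∣ S ∣ ≡ r ∸ 1 →
      (∣ S ∩ Lset l a ∣ ≤ 1 → RealField._≈_ R (dot R (cv S) (cv S)) (RealField.1# R))
      × (2 ≤ ∣ S ∩ Lset l a ∣ → ∀ i → RealField._≈_ R (lookup (cv S) i) (RealField.0# R)))
    × (∀ (S T : Subset (l + a)) → ∣ S ∣ ≡ r ∸ 1 → ∣ T ∣ ≡ r ∸ 1 → (p : Fin l) →
      S ∩ Lset l a ≡ ⁅ p ↑ˡ a ⁆ → T ∩ Lset l a ≡ ⁅ p ↑ˡ a ⁆ →
      ∀ i → RealField._≈_ R (lookup (cv S) i) (lookup (cv T) i))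
lemma3p2 R (suc d) l a n (s≤s _) _ _ cv hyp =
  (λ S ∣S∣≡d → ∣c∣²≈1 R d l a cv hyp S ∣S∣≡d , c≈0 R d l a cv hyp S ∣S∣≡d) ,
  (λ S T ∣S∣≡d ∣T∣≡d p S∩L≡p T∩L≡p →
    c≈c R d l a cv hyp S T ∣S∣≡d ∣T∣≡d (trans S∩L≡p (sym T∩L≡p)) (trans (cong ∣_∣ S∩L≡p) (∣⁅x⁆∣≡1 (p ↑ˡ a))))
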